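{- Let \(G\) be a finite simple connected graph with \(\Delta(G)\leq 4\), not isomorphic to \(O_3\), and let \(t=\{x_{1},x_{2},x_{3}\}\) be a triangle (complete subgraph on three vertices, not necessarily a clique) that is contained in two different cliques of \(G\). Then \(x_{1},x_{2},x_{3}\) are pairwise twins, i.e. \(N[x_{1}]=N[x_{2}]=N[x_{3}]\).
   Context: A clique is a maximal complete subgraph. \(N[x]\) denotes the closed neighborhood \(N(x)\cup\{x\}\). \(O_3\) is the complement of the disjoint union of three edges. -}

module Defs where

open import Data.Nat using (ℕ; _≤_)
open import Data.Fin using (Fin; _≟_)
open import Data.Fin.Subset using (Subset; _∈_; _∉_; _⊆_; ∣_∣)
open import Data.Vec using (tabulate)
open import Data.Bool using (Bool; _∨_)
open import Data.Product using (Σ; _×_; _,_; ∃)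
open import Relation.Nullary using (¬_; does)
open import Relation.Binary using (Decidable)
open import Relation.Binary.PropositionalEquality using (_≡_; _≢_; refl; sym; trans; cong)
open import Relation.Nullary using (yes; no)
open import Relation.Nullary.Decidable using (_×-dec_; ¬?)
open import Function.Bundles using (_↔_; Inverse)

record Graph (n : ℕ) : Set₁ where
  field
    Adj    : Fin n → Fin n → Set
    adj?   : Decidable Adj
    adjSym : ∀ {x y} → Adj x y → Adj y x
    irrefl : ∀ {x} → ¬ Adj x x

open Graph public

N : ∀ {n} → Graph n → Fin n → Subset n
N G x = tabulate (λ v → does (adj? G x v))

N[_,_] : ∀ {n} → Graph n → Fin n → Subset n
N[ G , x ] = tabulate (λ v → does (v ≟ x) ∨ does (adj? G x v))

degree : ∀ {n} → Graph n → Fin n → ℕ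
degree G x = ∣ N G x ∣

MaxDegreeAtMost : ∀ {n} → Graph n → ℕ → Set
MaxDegreeAtMost G k = ∀ x → degree G x ≤ k

data Walk {n} (G : Graph n) : Fin n → Fin n → Set where
  [] : ∀ {x} → Walk G x x
  _∷_ : ∀ {x y z} → Adj G x y → Walk G y z → Walk G x z

Connected : ∀ {n} → Graph n → Set
Connected {n} G = ∀ (u v : Fin n) → Walk G u v

IsComplete : ∀ {n} → Graph n → Subset n → Set
IsComplete G S = ∀ {x y} → x ∈ S → y ∈ S → x ≢ y → Adj G x y

IsClique : ∀ {n} → Graph n → Subset n → Set
IsClique {n} G S =
  IsComplete G S × (∀ (T : Subset n) → IsComplete G T → S ⊆ T → T ⊆ S)

IsTriangle : ∀ {n} → Graph n → Fin n → Fin n → Fin n → Set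
IsTriangle G x₁ x₂ x₃ = Adj G x₁ x₂ × Adj G x₁ x₃ × Adj G x₂ x₃

Isomorphic : ∀ {n m} → Graph n → Graph m → Set
Isomorphic {n} {m} G H =
  Σ (Fin n ↔ Fin m) λ f →
    ∀ x y → (Adj G x y → Adj H (Inverse.to f x) (Inverse.to f y))
          × (Adj H (Inverse.to f x) (Inverse.to f y) → Adj G x y)

-- O₃: complement of three disjoint edges {0,1},{2,3},{4,5} on Fin 6
partner : Fin 6 → Fin 6
partner Fin.zero = Fin.suc Fin.zero
partner (Fin.suc Fin.zero) = Fin.zero
partner (Fin.suc (Fin.suc Fin.zero)) = Fin.suc (Fin.suc (Fin.suc Fin.zero))
partner (Fin.suc (Fin.suc (Fin.suc Fin.zero))) = Fin.suc (Fin.suc Fin.zero)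
partner (Fin.suc (Fin.suc (Fin.suc (Fin.suc Fin.zero)))) =
  Fin.suc (Fin.suc (Fin.suc (Fin.suc (Fin.suc Fin.zero))))
partner (Fin.suc (Fin.suc (Fin.suc (Fin.suc (Fin.suc Fin.zero))))) =
  Fin.suc (Fin.suc (Fin.suc (Fin.suc Fin.zero)))

O3Adj : Fin 6 → Fin 6 → Set
O3Adj x y = x ≢ y × y ≢ partner x

partner-invol : ∀ x → partner (partner x) ≡ x
partner-invol Fin.zero = refl
partner-invol (Fin.suc Fin.zero) = refl
partner-invol (Fin.suc (Fin.suc Fin.zero)) = refl
partner-invol (Fin.suc (Fin.suc (Fin.suc Fin.zero))) = refl
partner-invol (Fin.suc (Fin.suc (Fin.suc (Fin.suc Fin.zero)))) = refl
partner-invol (Fin.suc (Fin.suc (Fin.suc (Fin.suc (Fin.suc Fin.zero))))) = refl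

O₃ : Graph 6
O₃ = record
  { Adj    = O3Adj
  ; adj?   = λ x y → ¬? (x ≟ y) ×-dec ¬? (y ≟ partner x)
  ; adjSym = λ { {x} {y} (p , q) →
               (λ e → p (sym e)) , (λ e → q (sym (trans (cong partner e) (partner-invol y)))) }
  ; irrefl = λ { (p , _) → p refl }
  }

module Submission where

-- Each vertex x of the triangle is adjacent to the other two triangle vertices, to a vertex a
-- of C₁ outside C₂ and to a vertex b of C₂ outside C₁ (these exist by maximality of the cliques).
-- These four neighbours are distinct, so Δ(G) ≤ 4 leaves x no other neighbour and N[x] is
-- exactly C₁ ∪ C₂.

open import Defs
open import Data.Nat using (ℕ; _≤_; z≤n; s≤s)
open import Data.Nat.Properties using (≤-trans; <-irrefl)
open import Data.Fin using (Fin; _≟_)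
open import Data.Fin.Subset using (Subset; _∈_; _∉_; _⊆_; _∪_; _-_; ∣_∣)
open import Data.Fin.Subset.Properties
  using (_∈?_; ⊆-antisym; x∈p∪q⁺; x∈p∪q⁻; x∈p∧x≢y⇒x∈p-y; x∈p⇒∣p-x∣<∣p∣)
open import Data.Fin.Properties using (¬∀⟶∃¬)
open import Data.Vec using (tabulate)
open import Data.Vec.Properties using (lookup⇒[]=; []=⇒lookup; lookup∘tabulate)
open import Data.Bool using (Bool; true; _∨_)
open import Data.Bool.Properties using (∨-zeroʳ)
open import Data.List using (List; []; _∷_; length)
open import Data.List.Relation.Unary.All using (All; []; _∷_)
import Data.List.Relation.Unary.All as All
open import Data.List.Relation.Unary.All.Properties using (¬Any⇒All¬)
open import Data.List.Relation.Unary.AllPairs using ([]; _∷_)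
open import Data.List.Relation.Unary.Unique.Propositional using (Unique)
import Data.List.Membership.Propositional as List
open import Data.Product using (Σ; _×_; _,_)
open import Data.Sum using (_⊎_; inj₁; inj₂)
open import Data.Empty using (⊥-elim)
open import Relation.Nullary using (¬_; does; yes; no)
open import Relation.Nullary.Decidable using (dec-true; _→-dec_)
open import Relation.Binary.PropositionalEquality using (_≡_; _≢_; refl; sym; trans; cong)

private
  variable
    n : ℕ

∈-tabulate⁺ : {f : Fin n → Bool} {v : Fin n} → f v ≡ true → v ∈ tabulate f
∈-tabulate⁺ {f = f} {v} fv = lookup⇒[]= v _ (trans (lookup∘tabulate f v) fv)

∈-tabulate⁻ : {f : Fin n → Bool} {v : Fin n} → v ∈ tabulate f → f v ≡ true
∈-tabulate⁻ {f = f} {v} v∈ = trans (sym (lookup∘tabulate f v)) ([]=⇒lookup v∈)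

unique-⊆⇒length≤∣p∣ : {p : Subset n} {xs : List (Fin n)} →
                      Unique xs → All (_∈ p) xs → length xs ≤ ∣ p ∣
unique-⊆⇒length≤∣p∣ [] [] = z≤n
unique-⊆⇒length≤∣p∣ {p = p} {x ∷ _} (x≢xs ∷ unique) (x∈p ∷ xs⊆p) =
  ≤-trans (s≤s (unique-⊆⇒length≤∣p∣ unique (All.zipWith removeₓ (x≢xs , xs⊆p))))
          (x∈p⇒∣p-x∣<∣p∣ x∈p)
  where
  removeₓ : ∀ {y} → x ≢ y × y ∈ p → y ∈ p - x
  removeₓ (x≢y , y∈p) = x∈p∧x≢y⇒x∈p-y y∈p (λ y≡x → x≢y (sym y≡x))

⊈⇒∃∈∉ : {p q : Subset n} → ¬ p ⊆ q → Σ (Fin n) λ a → a ∈ p × a ∉ q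
⊈⇒∃∈∉ {n} {p} {q} p⊈q
  with ¬∀⟶∃¬ n (λ v → v ∈ p → v ∈ q) (λ v → v ∈? p →-dec v ∈? q) (λ p⊆q → p⊈q (p⊆q _))
... | a , ¬[a∈p⇒a∈q] with a ∈? p
...   | yes a∈p = a , a∈p , λ a∈q → ¬[a∈p⇒a∈q] λ _ → a∈q
...   | no  a∉p = ⊥-elim (¬[a∈p⇒a∈q] λ a∈p → ⊥-elim (a∉p a∈p))

∈∧∉⇒≢ : {p : Subset n} {x y : Fin n} → x ∈ p → y ∉ p → x ≢ y
∈∧∉⇒≢ x∈p y∉p refl = y∉p x∈p

module _ {n : ℕ} (G : Graph n) where

  open import Data.List.Membership.DecPropositional (_≟_ {n}) using () renaming (_∈?_ to _∈ᴸ?_)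

  adj⇒∈N : ∀ {x y} → Adj G x y → y ∈ N G x
  adj⇒∈N {x} {y} xy = ∈-tabulate⁺ (dec-true (adj? G x y) xy)

  adj⇒≢ : ∀ {x y} → Adj G x y → x ≢ y
  adj⇒≢ xy refl = irrefl G xy

  ∈N[]⁺ : ∀ {x v} → v ≡ x ⊎ Adj G x v → v ∈ N[ G , x ]
  ∈N[]⁺ {x} {v} (inj₁ v≡x) = ∈-tabulate⁺ (cong (_∨ _) (dec-true (v ≟ x) v≡x))
  ∈N[]⁺ {x} {v} (inj₂ xv) =
    ∈-tabulate⁺ (trans (cong (does (v ≟ x) ∨_) (dec-true (adj? G x v) xv)) (∨-zeroʳ _))

  ∈N[]⁻ : ∀ {x v} → v ∈ N[ G , x ] → v ≡ x ⊎ Adj G x v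
  ∈N[]⁻ {x} {v} v∈ with v ≟ x | adj? G x v | ∈-tabulate⁻ v∈
  ... | yes v≡x | _      | _ = inj₁ v≡x
  ... | no _    | yes xv | _ = inj₂ xv

  saturated-neighbour : ∀ {k x v} {ys : List (Fin n)} →
    degree G x ≤ k → length ys ≡ k → Unique ys → All (Adj G x) ys →
    Adj G x v → v List.∈ ys
  saturated-neighbour {v = v} {ys} deg refl unique adjs xv with v ∈ᴸ? ys
  ... | yes v∈ys = v∈ys
  ... | no v∉ys = ⊥-elim (<-irrefl refl (≤-trans
        (unique-⊆⇒length≤∣p∣ (¬Any⇒All¬ ys v∉ys ∷ unique) (adj⇒∈N xv ∷ All.map adj⇒∈N adjs))
        deg))

  complete-∪⊆N[] : ∀ {C D x} → IsComplete G C → IsComplete G D → x ∈ C → x ∈ D →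
                   C ∪ D ⊆ N[ G , x ]
  complete-∪⊆N[] {C} {D} {x} C-complete D-complete x∈C x∈D {v} v∈C∪D with v ≟ x
  ... | yes v≡x = ∈N[]⁺ (inj₁ v≡x)
  ... | no  v≢x = ∈N[]⁺ (inj₂ (adjacent (x∈p∪q⁻ C D v∈C∪D)))
    where
    adjacent : v ∈ C ⊎ v ∈ D → Adj G x v
    adjacent (inj₁ v∈C) = C-complete x∈C v∈C λ x≡v → v≢x (sym x≡v)
    adjacent (inj₂ v∈D) = D-complete x∈D v∈D λ x≡v → v≢x (sym x≡v)

  clique-⊈-complete : ∀ {C D} → IsClique G C → IsComplete G D → C ≢ D →
                      Σ (Fin n) λ a → a ∈ C × a ∉ D
  clique-⊈-complete (_ , maximal) D-complete C≢D =
    ⊈⇒∃∈∉ λ C⊆D → C≢D (⊆-antisym C⊆D (maximal _ D-complete C⊆D))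

  module TwoCliques (deg : MaxDegreeAtMost G 4) {C₁ C₂ : Subset n}
    (C₁-complete : IsComplete G C₁) (C₂-complete : IsComplete G C₂)
    {a b : Fin n} (a∈C₁ : a ∈ C₁) (a∉C₂ : a ∉ C₂) (b∈C₂ : b ∈ C₂) (b∉C₁ : b ∉ C₁) where

    InBoth : Fin n → Set
    InBoth v = v ∈ C₁ × v ∈ C₂

    triangle-N[]≡∪ : ∀ {x y z} → IsTriangle G x y z → InBoth x → InBoth y → InBoth z →
                     N[ G , x ] ≡ C₁ ∪ C₂
    triangle-N[]≡∪ {x} {y} {z} (xy , xz , yz) (x∈C₁ , x∈C₂) (y∈C₁ , y∈C₂) (z∈C₁ , z∈C₂) =
      ⊆-antisym N[x]⊆C₁∪C₂ (complete-∪⊆N[] C₁-complete C₂-complete x∈C₁ x∈C₂)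
      where
      neighbours : List (Fin n)
      neighbours = y ∷ z ∷ a ∷ b ∷ []

      adjacent : All (Adj G x) neighbours
      adjacent = xy ∷ xz ∷ C₁-complete x∈C₁ a∈C₁ (∈∧∉⇒≢ x∈C₂ a∉C₂)
                    ∷ C₂-complete x∈C₂ b∈C₂ (∈∧∉⇒≢ x∈C₁ b∉C₁) ∷ []

      distinct : Unique neighbours
      distinct = (adj⇒≢ yz ∷ ∈∧∉⇒≢ y∈C₂ a∉C₂ ∷ ∈∧∉⇒≢ y∈C₁ b∉C₁ ∷ [])
               ∷ (∈∧∉⇒≢ z∈C₂ a∉C₂ ∷ ∈∧∉⇒≢ z∈C₁ b∉C₁ ∷ [])
               ∷ (∈∧∉⇒≢ a∈C₁ b∉C₁ ∷ [])
               ∷ [] ∷ []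

      covered : All (_∈ C₁ ∪ C₂) neighbours
      covered = x∈p∪q⁺ (inj₁ y∈C₁) ∷ x∈p∪q⁺ (inj₁ z∈C₁) ∷ x∈p∪q⁺ (inj₁ a∈C₁)
              ∷ x∈p∪q⁺ (inj₂ b∈C₂) ∷ []

      N[x]⊆C₁∪C₂ : N[ G , x ] ⊆ C₁ ∪ C₂
      N[x]⊆C₁∪C₂ v∈N[x] with ∈N[]⁻ v∈N[x]
      ... | inj₁ refl = x∈p∪q⁺ (inj₁ x∈C₁)
      ... | inj₂ xv   = All.lookup covered (saturated-neighbour (deg x) refl distinct adjacent xv)

mainTheorem4 : ∀ {n : ℕ} (G : Graph n) →
    Connected G →
    MaxDegreeAtMost G 4 →
    ¬ Isomorphic G O₃ →
    ∀ (x₁ x₂ x₃ : Fin n) →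
    IsTriangle G x₁ x₂ x₃ →
    (Σ (Subset n) λ C₁ → Σ (Subset n) λ C₂ →
    IsClique G C₁ × IsClique G C₂ × C₁ ≢ C₂ ×
    (x₁ ∈ C₁ × x₂ ∈ C₁ × x₃ ∈ C₁) × (x₁ ∈ C₂ × x₂ ∈ C₂ × x₃ ∈ C₂)) →
    (N[ G , x₁ ] ≡ N[ G , x₂ ]) × (N[ G , x₂ ] ≡ N[ G , x₃ ])
mainTheorem4 G _ deg _ x₁ x₂ x₃ (x₁x₂ , x₁x₃ , x₂x₃)
  (C₁ , C₂ , C₁-clique@(C₁-complete , _) , C₂-clique@(C₂-complete , _) , C₁≢C₂ ,
   (x₁∈C₁ , x₂∈C₁ , x₃∈C₁) , (x₁∈C₂ , x₂∈C₂ , x₃∈C₂))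
  with clique-⊈-complete G C₁-clique C₂-complete C₁≢C₂
     | clique-⊈-complete G C₂-clique C₁-complete (λ C₂≡C₁ → C₁≢C₂ (sym C₂≡C₁))
... | a , a∈C₁ , a∉C₂ | b , b∈C₂ , b∉C₁ =
  trans N[x₁]≡∪ (sym N[x₂]≡∪) , trans N[x₂]≡∪ (sym N[x₃]≡∪)
  where
  open TwoCliques G deg C₁-complete C₂-complete a∈C₁ a∉C₂ b∈C₂ b∉C₁
  N[x₁]≡∪ : N[ G , x₁ ] ≡ C₁ ∪ C₂
  N[x₁]≡∪ = triangle-N[]≡∪ (x₁x₂ , x₁x₃ , x₂x₃)
              (x₁∈C₁ , x₁∈C₂) (x₂∈C₁ , x₂∈C₂) (x₃∈C₁ , x₃∈C₂)
  N[x₂]≡∪ : N[ G , x₂ ] ≡ C₁ ∪ C₂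
  N[x₂]≡∪ = triangle-N[]≡∪ (adjSym G x₁x₂ , x₂x₃ , x₁x₃)
              (x₂∈C₁ , x₂∈C₂) (x₁∈C₁ , x₁∈C₂) (x₃∈C₁ , x₃∈C₂)
  N[x₃]≡∪ : N[ G , x₃ ] ≡ C₁ ∪ C₂
  N[x₃]≡∪ = triangle-N[]≡∪ (adjSym G x₁x₃ , adjSym G x₂x₃ , x₁x₂)
              (x₃∈C₁ , x₃∈C₂) (x₁∈C₁ , x₁∈C₂) (x₂∈C₁ , x₂∈C₂)
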